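{- Let $k\ge 2$ and let $G$ be a graph containing $m$ cycles of length $2k$, each of which contains a fixed edge $e \in G$. Then the number of edges of $G$ satisfies $|G| \geq m^{1/(k - 1)}/2$.
   Context: $|G|$ denotes the number of edges of $G$. -}

module Defs where

open import Data.Nat using (ℕ; zero; suc; _+_; _*_; _^_; _<ᵇ_)
open import Data.Nat.DivMod using (_%_; m%n<n)
open import Data.Fin using (Fin; toℕ; fromℕ<)
open import Data.Bool using (Bool; true; false; T; _∧_; if_then_else_)
open import Data.List using (List; allFin; cartesianProductWith; map; length)
open import Data.Nat.ListAction using (sum)
open import Data.List.Relation.Unary.All using (All)
open import Data.List.Relation.Unary.AllPairs using (AllPairs)
open import Data.Product using (Σ; _×_; ∃-syntax)
open import Data.Sum using (_⊎_)
open import Function.Definitions using (Injective)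
open import Function.Bundles using (_⇔_)
open import Relation.Binary.PropositionalEquality using (_≡_)
open import Relation.Nullary using (¬_)

record Graph : Set where
  field
    n     : ℕ
    adj   : Fin n → Fin n → Bool
    sym   : ∀ x y → adj x y ≡ adj y x
    irrefl : ∀ x → adj x x ≡ false
open Graph public

Adj : (G : Graph) → Fin (n G) → Fin (n G) → Set
Adj G x y = T (adj G x y)

edgeCount : Graph → ℕ
edgeCount G = sum (cartesianProductWith f (allFin (n G)) (allFin (n G)))
  where
  f : Fin (n G) → Fin (n G) → ℕ
  f x y = if (toℕ x <ᵇ toℕ y) ∧ adj G x y then 1 else 0

next : ∀ {l} → Fin (suc l) → Fin (suc l)
next {l} i = fromℕ< (m%n<n (suc (toℕ i)) (suc l))

-- A cycle of length (suc l) in G: distinct vertices v 0, ..., v l with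
-- v i adjacent to v (i+1 mod (suc l)).  (Used with suc l = 2k ≥ 4.)
record Cycle (G : Graph) (l : ℕ) : Set where
  field
    v    : Fin (suc l) → Fin (n G)
    inj  : Injective _≡_ _≡_ v
    adjs : ∀ i → Adj G (v i) (v (next i))
open Cycle public

CEdge : ∀ {G l} → Cycle G l → Fin (n G) → Fin (n G) → Set
CEdge c x y = ∃[ i ] ((v c i ≡ x × v c (next i) ≡ y) ⊎ (v c i ≡ y × v c (next i) ≡ x))

-- Two cycles are the same cycle (subgraph) iff they have the same edge set.
SameCycle : ∀ {G l} → Cycle G l → Cycle G l → Set
SameCycle c d = ∀ x y → CEdge c x y ⇔ CEdge d x y

Distinct : ∀ {G l} → Cycle G l → Cycle G l → Set
Distinct c d = ¬ SameCycle c d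

{-# OPTIONS --safe #-}
-- Traverse a 2k-cycle through e = {x , y} as the closed walk
-- y = u₀, u₁, …, u₂ₖ₋₁ = x, u₂ₖ = y.  Together with its ends, the k − 1 arcs
-- (u₁ , u₂), (u₃ , u₄), …, (u₂ₖ₋₃ , u₂ₖ₋₂) fix every vertex of the walk, hence
-- the cycle; each arc is one of the 2|G| ordered pairs of adjacent vertices.  So distinct cycles
-- through e get distinct words of length k − 1 over 2|G| letters.
module Submission where

open import Defs hiding (sym)
open import Data.Bool using (Bool; true; false; T; _∧_; if_then_else_)
open import Data.Bool.Properties using (T-∧)
open import Data.Empty using (⊥-elim)
open import Data.Fin using (Fin; toℕ; fromℕ<)
open import Data.Fin.Properties using (toℕ<n; toℕ-injective; fromℕ<-cong; fromℕ<-toℕ; toℕ-fromℕ<)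
open import Data.List using (List; []; _∷_; [_]; _++_; length; map; filterᵇ; cartesianProductWith; cartesianProduct; allFin)
open import Data.List.Membership.Propositional using (_∈_; _─_)
open import Data.List.Membership.Propositional.Properties using (∈-filter⁺; ∈-cartesianProduct⁺; ∈-cartesianProductWith⁺; ∈-allFin; ∈-map⁺; ∈-++⁺ˡ; ∈-++⁺ʳ)
open import Data.List.Properties using (length-++; length-map; map-++; map-∘; length-removeAt′)
open import Data.List.Relation.Unary.All as All using (All)
open import Data.List.Relation.Unary.AllPairs using (AllPairs)
open import Data.List.Relation.Unary.Any using (here; there; index)
open import Data.List.Relation.Unary.Unique.Propositional using (Unique)
open import Data.Nat using (ℕ; zero; suc; _+_; _*_; _^_; _∸_; _≤_; _<_; _<ᵇ_; z≤n; s≤s; s≤s⁻¹; NonZero)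
open import Data.Nat.DivMod using (_%_; _/_; m%n<n; m≡m%n+[m/n]*n; [m+n]%n≡m%n; m<n⇒m%n≡m)
open import Data.Nat.ListAction using (sum)
open import Data.Nat.Properties using (module ≤-Reasoning; +-identityʳ; +-assoc; +-comm; +-suc; *-zeroʳ; <-cmp; <⇒<ᵇ)
open import Data.Nat.Tactic.RingSolver using (solve)
open import Data.Product using (_×_; _,_; ∃-syntax; proj₁; proj₂; swap)
open import Data.Sum using (_⊎_; inj₁; inj₂)
open import Data.Vec using (Vec)
open import Data.Vec.Properties using (∷-injectiveˡ; ∷-injectiveʳ)
open import Function using (_∘_)
open import Function.Bundles using (mk⇔; Equivalence)
open import Relation.Binary.Definitions using (tri<; tri≈; tri>)
open import Relation.Binary.PropositionalEquality using (_≡_; _≢_; _≗_; refl; sym; trans; cong; cong₂; subst; module ≡-Reasoning)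
open import Relation.Nullary using (¬_)

module _ {A B C : Set} where

  length-cartesianProductWith : ∀ (f : A → B → C) xs ys →
                                length (cartesianProductWith f xs ys) ≡ length xs * length ys
  length-cartesianProductWith f []       ys = refl
  length-cartesianProductWith f (x ∷ xs) ys = begin
    length (map (f x) ys ++ cartesianProductWith f xs ys)
      ≡⟨ length-++ (map (f x) ys) ⟩
    length (map (f x) ys) + length (cartesianProductWith f xs ys)
      ≡⟨ cong₂ _+_ (length-map (f x) ys) (length-cartesianProductWith f xs ys) ⟩
    length ys + length xs * length ys ∎
    where open ≡-Reasoning

  map-cartesianProductWith : ∀ {D : Set} (h : C → D) (f : A → B → C) xs ys →
                             map h (cartesianProductWith f xs ys) ≡ cartesianProductWith (λ a b → h (f a b)) xs ys
  map-cartesianProductWith h f []       ys = refl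
  map-cartesianProductWith h f (x ∷ xs) ys = begin
    map h (map (f x) ys ++ cartesianProductWith f xs ys)
      ≡⟨ map-++ h (map (f x) ys) _ ⟩
    map h (map (f x) ys) ++ map h (cartesianProductWith f xs ys)
      ≡⟨ cong₂ _++_ (sym (map-∘ ys)) (map-cartesianProductWith h f xs ys) ⟩
    map (h ∘ f x) ys ++ cartesianProductWith (λ a b → h (f a b)) xs ys ∎
    where open ≡-Reasoning

-- The constructors of All, AllPairs and Vec are opened only locally: where they
-- overload those of List, the ring solver cannot read its list of variables.
module _ {A : Set} where
  open import Data.List.Relation.Unary.All using ([]; _∷_)
  open import Data.List.Relation.Unary.AllPairs using (_∷_)
  open import Data.Vec using ([]; _∷_)

  ∈-─⁺ : ∀ {x z : A} {ys} (x∈ys : x ∈ ys) → x ≢ z → z ∈ ys → z ∈ ys ─ x∈ys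
  ∈-─⁺ (here refl) x≢z (here refl)  = ⊥-elim (x≢z refl)
  ∈-─⁺ (here _)    _   (there z∈ys) = z∈ys
  ∈-─⁺ (there _)   _   (here refl)  = here refl
  ∈-─⁺ (there x∈ys) x≢z (there z∈ys) = there (∈-─⁺ x∈ys x≢z z∈ys)

  Unique-⊆⇒length≤ : ∀ {xs ys : List A} → Unique xs → All (_∈ ys) xs → length xs ≤ length ys
  Unique-⊆⇒length≤ {[]}     _             _               = z≤n
  Unique-⊆⇒length≤ {x ∷ xs} {ys} (x∉xs ∷ xs!) (x∈ys ∷ xs⊆ys) =
    subst (suc (length xs) ≤_) (sym (length-removeAt′ ys (index x∈ys)))
      (s≤s (Unique-⊆⇒length≤ xs! (All.zipWith (λ (x≢z , z∈ys) → ∈-─⁺ x∈ys x≢z z∈ys) (x∉xs , xs⊆ys))))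

  length-filterᵇ : ∀ (p : A → Bool) xs → length (filterᵇ p xs) ≡ sum (map (λ a → if p a then 1 else 0) xs)
  length-filterᵇ p []       = refl
  length-filterᵇ p (x ∷ xs) with p x
  ... | true  = cong suc (length-filterᵇ p xs)
  ... | false = length-filterᵇ p xs

  vectors : List A → (m : ℕ) → List (Vec A m)
  vectors xs zero    = [ [] ]
  vectors xs (suc m) = cartesianProductWith _∷_ xs (vectors xs m)

  length-vectors : ∀ (xs : List A) m → length (vectors xs m) ≡ length xs ^ m
  length-vectors xs zero    = refl
  length-vectors xs (suc m) =
    trans (length-cartesianProductWith _∷_ xs (vectors xs m)) (cong (length xs *_) (length-vectors xs m))

module _ {A B : Set} {P : A → Set} (f : ∀ a → P a → B) where
  open import Data.List.Relation.Unary.All using ([]; _∷_)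
  open import Data.List.Relation.Unary.AllPairs using ([]; _∷_)

  reduce : ∀ {xs} → All P xs → List B
  reduce = All.reduce (λ {a} → f a)

  length-reduce : ∀ {xs} (ps : All P xs) → length (reduce ps) ≡ length xs
  length-reduce []       = refl
  length-reduce (p ∷ ps) = cong suc (length-reduce ps)

  reduce-⊆ : ∀ {xs ys} → (∀ a (p : P a) → f a p ∈ ys) → (ps : All P xs) → All (_∈ ys) (reduce ps)
  reduce-⊆ f∈ys []       = []
  reduce-⊆ f∈ys (p ∷ ps) = f∈ys _ p ∷ reduce-⊆ f∈ys ps

  reduce-Unique : ∀ {R : A → A → Set} {xs} → (∀ a b (p : P a) (q : P b) → R a b → f a p ≢ f b q) →
                  AllPairs R xs → (ps : All P xs) → Unique (reduce ps)
  reduce-Unique separates []         []       = []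
  reduce-Unique {R} separates (Rx ∷ Rxs) (p ∷ ps) = fresh Rx ps ∷ reduce-Unique separates Rxs ps
    where
    fresh : ∀ {zs} → All (R _) zs → (qs : All P zs) → All (f _ p ≢_) (reduce qs)
    fresh []         []       = []
    fresh (Rz ∷ Rzs) (q ∷ qs) = separates _ _ p q Rz ∷ fresh Rzs qs

module _ (G : Graph) where

  Adj-sym : ∀ {a b} → Adj G a b → Adj G b a
  Adj-sym {a} {b} = subst T (Graph.sym G a b)

  Adj-irrefl : ∀ {a} → ¬ Adj G a a
  Adj-irrefl {a} = subst T (irrefl G a)

  isForwardEdge : Fin (n G) × Fin (n G) → Bool
  isForwardEdge (a , b) = (toℕ a <ᵇ toℕ b) ∧ adj G a b

  forwardEdges : List (Fin (n G) × Fin (n G))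
  forwardEdges = filterᵇ isForwardEdge (cartesianProduct (allFin (n G)) (allFin (n G)))

  arcs : List (Fin (n G) × Fin (n G))
  arcs = forwardEdges ++ map swap forwardEdges

  length-forwardEdges : length forwardEdges ≡ edgeCount G
  length-forwardEdges = trans (length-filterᵇ isForwardEdge (cartesianProduct vertices vertices))
                              (cong sum (map-cartesianProductWith _ _,_ vertices vertices))
    where vertices = allFin (n G)

  length-arcs : length arcs ≡ 2 * edgeCount G
  length-arcs = begin
    length (forwardEdges ++ map swap forwardEdges)
      ≡⟨ length-++ forwardEdges ⟩
    length forwardEdges + length (map swap forwardEdges)
      ≡⟨ cong (length forwardEdges +_) (length-map swap forwardEdges) ⟩
    length forwardEdges + length forwardEdges
      ≡⟨ cong₂ _+_ length-forwardEdges length-forwardEdges ⟩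
    edgeCount G + edgeCount G
      ≡⟨ cong (edgeCount G +_) (sym (+-identityʳ (edgeCount G))) ⟩
    2 * edgeCount G ∎
    where open ≡-Reasoning

  ∈-forwardEdges : ∀ {a b} → toℕ a < toℕ b → Adj G a b → (a , b) ∈ forwardEdges
  ∈-forwardEdges {a} {b} a<b ab =
    ∈-filter⁺ _ (∈-cartesianProduct⁺ (∈-allFin a) (∈-allFin b)) (Equivalence.from T-∧ (<⇒<ᵇ a<b , ab))

  ∈-arcs : ∀ {a b} → Adj G a b → (a , b) ∈ arcs
  ∈-arcs {a} {b} ab with <-cmp (toℕ a) (toℕ b)
  ... | tri< a<b _ _ = ∈-++⁺ˡ (∈-forwardEdges a<b ab)
  ... | tri≈ _ a≡b _ = ⊥-elim (Adj-irrefl (subst (Adj G a) (sym (toℕ-injective a≡b)) ab))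
  ... | tri> _ _ b<a = ∈-++⁺ʳ forwardEdges (∈-map⁺ swap (∈-forwardEdges b<a (Adj-sym ab)))

module _ {V : Set} where

  -- CEdge c a b unfolds to ∃[ i ] SameEnds (v c i) (v c (next i)) a b.
  SameEnds : V → V → V → V → Set
  SameEnds p q a b = (p ≡ a × q ≡ b) ⊎ (p ≡ b × q ≡ a)

  SameEnds-sym : ∀ {p q a b} → SameEnds p q a b → SameEnds a b p q
  SameEnds-sym (inj₁ (refl , refl)) = inj₁ (refl , refl)
  SameEnds-sym (inj₂ (refl , refl)) = inj₂ (refl , refl)

  SameEnds-trans : ∀ {p q r s a b} → SameEnds p q r s → SameEnds r s a b → SameEnds p q a b
  SameEnds-trans (inj₁ (refl , refl)) e                    = e
  SameEnds-trans (inj₂ (refl , refl)) (inj₁ (refl , refl)) = inj₂ (refl , refl)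
  SameEnds-trans (inj₂ (refl , refl)) (inj₂ (refl , refl)) = inj₁ (refl , refl)

  WalkEdge : (ℕ → V) → V → V → Set
  WalkEdge u a b = ∃[ t ] SameEnds (u t) (u (suc t)) a b

  infix 4 _⊑_
  _⊑_ : (ℕ → V) → (ℕ → V) → Set
  u ⊑ w = ∀ t → ∃[ j ] SameEnds (u t) (u (suc t)) (w j) (w (suc j))

  ≗⇒⊑ : ∀ {u w} → u ≗ w → u ⊑ w
  ≗⇒⊑ u≗w t = t , inj₁ (u≗w t , u≗w (suc t))

  ⊑-trans : ∀ {u v w} → u ⊑ v → v ⊑ w → u ⊑ w
  ⊑-trans u⊑v v⊑w t =
    let j , e = u⊑v t
        k , f = v⊑w j
    in k , SameEnds-trans e f

  ⊑⇒WalkEdge : ∀ {u w a b} → u ⊑ w → WalkEdge u a b → WalkEdge w a b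
  ⊑⇒WalkEdge u⊑w (t , e) = let j , f = u⊑w t in j , SameEnds-trans (SameEnds-sym f) e

  Periodic : ℕ → (ℕ → V) → Set
  Periodic L u = ∀ t → u (t + L) ≡ u t

  module _ {L : ℕ} {u : ℕ → V} (periodic : Periodic L u) where

    periodic-+* : ∀ t q → u (t + q * L) ≡ u t
    periodic-+* t zero    = cong u (+-identityʳ t)
    periodic-+* t (suc q) = begin
      u (t + (L + q * L)) ≡⟨ cong u (trans (cong (t +_) (+-comm L (q * L))) (sym (+-assoc t (q * L) L))) ⟩
      u (t + q * L + L)   ≡⟨ periodic (t + q * L) ⟩
      u (t + q * L)       ≡⟨ periodic-+* t q ⟩
      u t                 ∎
      where open ≡-Reasoning

    periodic-cong : ∀ {a b} p q → a + p * L ≡ b + q * L → u a ≡ u b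
    periodic-cong {a} {b} p q eq = trans (sym (periodic-+* a p)) (trans (cong u eq) (periodic-+* b q))

    periodic-% : .{{_ : NonZero L}} → ∀ t → u t ≡ u (t % L)
    periodic-% t = periodic-cong 0 (t / L) (trans (+-identityʳ t) (m≡m%n+[m/n]*n t L))

  agree-on-period⇒≗ : ∀ {L u u'} .{{_ : NonZero L}} → Periodic L u → Periodic L u' →
                      (∀ t → t < L → u t ≡ u' t) → u ≗ u'
  agree-on-period⇒≗ {L} u-periodic u'-periodic agree t =
    trans (periodic-% u-periodic t) (trans (agree (t % L) (m%n<n t L)) (sym (periodic-% u'-periodic t)))

module _ {V : Set} (l : ℕ) where

  rotate : ℕ → (ℕ → V) → ℕ → V
  rotate s w t = w (t + s)

  -- l ≡ −1 modulo the period suc l, so reflect s w t is "w (s − t)".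
  reflect : ℕ → (ℕ → V) → ℕ → V
  reflect s w t = w (l * t + s)

  rotate-⊑ : ∀ s w → rotate s w ⊑ w
  rotate-⊑ s w t = t + s , inj₁ (refl , refl)

  reflect-⊑ : ∀ {w} → Periodic (suc l) w → ∀ s → reflect s w ⊑ w
  reflect-⊑ {w} w-periodic s t = l + (l * t + s) ,
    inj₂ (periodic-cong w-periodic 1 0 (solve (t ∷ l ∷ s ∷ [])) , cong w (solve (t ∷ l ∷ s ∷ [])))

  module _ {w : ℕ → V} (w-periodic : Periodic (suc l) w) (s : ℕ) where

    rotate-periodic : Periodic (suc l) (rotate s w)
    rotate-periodic t = periodic-cong w-periodic 0 1 (solve (t ∷ l ∷ s ∷ []))

    reflect-periodic : Periodic (suc l) (reflect s w)
    reflect-periodic t = periodic-cong w-periodic 0 l (solve (t ∷ l ∷ s ∷ []))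

    rotate-inverse : rotate (l * s) (rotate s w) ≗ w
    rotate-inverse t = periodic-cong w-periodic 0 s (solve (t ∷ l ∷ s ∷ []))

    reflect-involutive : reflect s (reflect s w) ≗ w
    reflect-involutive t = periodic-cong w-periodic t (s + l * t) (solve (t ∷ l ∷ s ∷ []))

    ⊑-rotate : w ⊑ rotate s w
    ⊑-rotate = ⊑-trans (≗⇒⊑ (sym ∘ rotate-inverse)) (rotate-⊑ (l * s) (rotate s w))

    ⊑-reflect : w ⊑ reflect s w
    ⊑-reflect = ⊑-trans (≗⇒⊑ (sym ∘ reflect-involutive)) (reflect-⊑ reflect-periodic s)

record Traversal {V : Set} (l : ℕ) (w : ℕ → V) (x y : V) : Set where
  field
    walk     : ℕ → V
    periodic : Periodic (suc l) walk
    starts   : walk 0 ≡ y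
    ends     : walk l ≡ x
    ⊑w       : walk ⊑ w
    w⊑       : w ⊑ walk

traversal : ∀ {V : Set} {l} {w : ℕ → V} {x y} → Periodic (suc l) w → WalkEdge w x y → Traversal l w x y
traversal {l = l} {w} w-periodic (i , inj₁ (wi≡x , wsi≡y)) = record
  { walk     = rotate l (suc i) w
  ; periodic = rotate-periodic l w-periodic (suc i)
  ; starts   = wsi≡y
  ; ends     = trans (periodic-cong w-periodic {l + suc i} {i} 0 1 (solve (l ∷ i ∷ []))) wi≡x
  ; ⊑w       = rotate-⊑ l (suc i) w
  ; w⊑       = ⊑-rotate l w-periodic (suc i)
  }
traversal {l = l} {w} w-periodic (i , inj₂ (wi≡y , wsi≡x)) = record
  { walk     = reflect l i w
  ; periodic = reflect-periodic l w-periodic i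
  ; starts   = trans (cong (λ z → w (z + i)) (*-zeroʳ l)) wi≡y
  ; ends     = trans (periodic-cong w-periodic {l * l + i} {suc i} 1 l (solve (l ∷ i ∷ []))) wsi≡x
  ; ⊑w       = reflect-⊑ l w-periodic i
  ; w⊑       = ⊑-reflect l w-periodic i
  }

module _ {G : Graph} {l : ℕ} (c : Cycle G l) where

  cycleWalk : ℕ → Fin (n G)
  cycleWalk t = v c (fromℕ< (m%n<n t (suc l)))

  cycleWalk-periodic : Periodic (suc l) cycleWalk
  cycleWalk-periodic t = cong (v c) (fromℕ<-cong _ _ ([m+n]%n≡m%n t (suc l)) _ _)

  cycleWalk-toℕ : ∀ i → cycleWalk (toℕ i) ≡ v c i
  cycleWalk-toℕ i = cong (v c) (trans (fromℕ<-cong _ _ (m<n⇒m%n≡m (toℕ<n i)) _ (toℕ<n i)) (fromℕ<-toℕ i (toℕ<n i)))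

  CEdge⇒WalkEdge : ∀ {a b} → CEdge c a b → WalkEdge cycleWalk a b
  CEdge⇒WalkEdge (i , e) = toℕ i , subst (λ p → SameEnds p (v c (next i)) _ _) (sym (cycleWalk-toℕ i)) e

  WalkEdge⇒CEdge : ∀ {a b} → WalkEdge cycleWalk a b → CEdge c a b
  WalkEdge⇒CEdge (t , e) = i , subst (λ q → SameEnds (cycleWalk t) q _ _) cycleWalk-suc e
    where
    i = fromℕ< (m%n<n t (suc l))
    cycleWalk-suc : cycleWalk (suc t) ≡ cycleWalk (suc (toℕ i))
    cycleWalk-suc = periodic-cong cycleWalk-periodic 0 (t / suc l) (begin
      suc t + 0                      ≡⟨ +-identityʳ (suc t) ⟩
      suc t                          ≡⟨ cong suc (m≡m%n+[m/n]*n t (suc l)) ⟩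
      suc (t % suc l + t / suc l * suc l) ≡⟨ cong (λ r → suc r + t / suc l * suc l) (sym (toℕ-fromℕ< _)) ⟩
      suc (toℕ i) + t / suc l * suc l ∎)
      where open ≡-Reasoning

  CEdge⇒Adj : ∀ {a b} → CEdge c a b → Adj G a b
  CEdge⇒Adj (i , inj₁ (refl , refl)) = adjs c i
  CEdge⇒Adj (i , inj₂ (refl , refl)) = Adj-sym G (adjs c i)

module _ {V : Set} where
  open import Data.Vec using ([]; _∷_)

  signature : (M : ℕ) → (ℕ → V) → Vec (V × V) M
  signature zero    u = []
  signature (suc M) u = (u 1 , u 2) ∷ signature M (λ t → u (2 + t))

  signature-∈-vectors : ∀ M {u : ℕ → V} (ps : List (V × V)) →
                        (∀ t → (u t , u (suc t)) ∈ ps) → signature M u ∈ vectors ps M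
  signature-∈-vectors zero    ps steps = here refl
  signature-∈-vectors (suc M) ps steps =
    ∈-cartesianProductWith⁺ _∷_ (steps 1) (signature-∈-vectors M ps (λ t → steps (2 + t)))

  signature-determines : ∀ M {u u' : ℕ → V} → signature M u ≡ signature M u' →
                         u 0 ≡ u' 0 → u (suc (M + M)) ≡ u' (suc (M + M)) →
                         ∀ t → t ≤ suc (M + M) → u t ≡ u' t
  signature-determines M       eq first last zero                _         = first
  signature-determines zero    eq first last (suc zero)          _         = last
  signature-determines zero    eq first last (suc (suc t))       (s≤s ())
  signature-determines (suc M) eq first last (suc zero)          _         = cong proj₁ (∷-injectiveˡ eq)
  signature-determines (suc M) {u} {u'} eq first last (suc (suc t)) (s≤s t≤) =
    signature-determines M (∷-injectiveʳ eq) (cong proj₂ (∷-injectiveˡ eq))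
      (subst (λ r → u (2 + r) ≡ u' (2 + r)) (+-suc M M) last)
      t (subst (t ≤_) (+-suc M M) (s≤s⁻¹ t≤))

module _ (G : Graph) (M : ℕ) {x y : Fin (n G)} where

  edgeTraversal : (c : Cycle G (suc (M + M))) → CEdge c x y → Traversal (suc (M + M)) (cycleWalk c) x y
  edgeTraversal c e = traversal (cycleWalk-periodic c) (CEdge⇒WalkEdge c e)

  cycleSignature : (c : Cycle G (suc (M + M))) → CEdge c x y → Vec (Fin (n G) × Fin (n G)) M
  cycleSignature c e = signature M (Traversal.walk (edgeTraversal c e))

  cycleSignature-∈ : ∀ c (e : CEdge c x y) → cycleSignature c e ∈ vectors (arcs G) M
  cycleSignature-∈ c e = signature-∈-vectors M (arcs G) λ t →
    ∈-arcs G (CEdge⇒Adj c (WalkEdge⇒CEdge c (⊑⇒WalkEdge ⊑w (t , inj₁ (refl , refl)))))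
    where open Traversal (edgeTraversal c e)

  cycleSignature-≡⇒SameCycle : ∀ c d (e : CEdge c x y) (f : CEdge d x y) →
                             cycleSignature c e ≡ cycleSignature d f → SameCycle c d
  cycleSignature-≡⇒SameCycle c d e f eq a b =
    mk⇔ (WalkEdge⇒CEdge d ∘ ⊑⇒WalkEdge c⊑d ∘ CEdge⇒WalkEdge c)
        (WalkEdge⇒CEdge c ∘ ⊑⇒WalkEdge d⊑c ∘ CEdge⇒WalkEdge d)
    where
    module C = Traversal (edgeTraversal c e)
    module D = Traversal (edgeTraversal d f)
    walks≗ : C.walk ≗ D.walk
    walks≗ = agree-on-period⇒≗ C.periodic D.periodic λ t t<L →
      signature-determines M eq (trans C.starts (sym D.starts)) (trans C.ends (sym D.ends)) t (s≤s⁻¹ t<L)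
    c⊑d = ⊑-trans C.w⊑ (⊑-trans (≗⇒⊑ walks≗) D.⊑w)
    d⊑c = ⊑-trans D.w⊑ (⊑-trans (≗⇒⊑ (sym ∘ walks≗)) C.⊑w)

  cycles-through-edge-bound : (cs : List (Cycle G (suc (M + M)))) → AllPairs Distinct cs →
                              All (λ c → CEdge c x y) cs → length cs ≤ (2 * edgeCount G) ^ M
  cycles-through-edge-bound cs distinct through = begin
    length cs                         ≡⟨ sym (length-reduce cycleSignature through) ⟩
    length (reduce cycleSignature through)
      ≤⟨ Unique-⊆⇒length≤ signatures-unique (reduce-⊆ cycleSignature cycleSignature-∈ through) ⟩
    length (vectors (arcs G) M)       ≡⟨ length-vectors (arcs G) M ⟩
    length (arcs G) ^ M               ≡⟨ cong (_^ M) (length-arcs G) ⟩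
    (2 * edgeCount G) ^ M             ∎
    where
    open ≤-Reasoning
    signatures-unique : Unique (reduce cycleSignature through)
    signatures-unique = reduce-Unique cycleSignature
      (λ c d e f c≢d → c≢d ∘ cycleSignature-≡⇒SameCycle c d e f) distinct through

2*[2+m]∸1≡1+[1+m]+[1+m] : ∀ m → 2 * suc (suc m) ∸ 1 ≡ suc (suc m + suc m)
2*[2+m]∸1≡1+[1+m]+[1+m] m = cong suc (trans (+-suc m (suc (m + 0))) (cong (λ r → suc (m + suc r)) (+-identityʳ m)))

lemma11 : (G : Graph) (k : ℕ) → 2 ≤ k →
            (x y : Fin (n G)) → Adj G x y →
            (cs : List (Cycle G (2 * k ∸ 1))) →
            AllPairs Distinct cs →
            All (λ c → CEdge c x y) cs →
            length cs ≤ (2 * edgeCount G) ^ (k ∸ 1)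
lemma11 G 1             (s≤s ())
lemma11 G (suc (suc m)) _        x y _ = bound (2*[2+m]∸1≡1+[1+m]+[1+m] m)
  where
  bound : ∀ {l} → l ≡ suc (suc m + suc m) → (cs : List (Cycle G l)) → AllPairs Distinct cs →
          All (λ c → CEdge c x y) cs → length cs ≤ (2 * edgeCount G) ^ suc m
  bound refl = cycles-through-edge-bound G (suc m)
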